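{- Let $\tau\colon LP\to UL'P'$ be a translation from $(L',\rho')$ to $(L,\rho)$ and suppose its adjoint transpose $\tau^\flat=\epsilon_{L'P'}\circ F\tau\colon FLP\to L'P'$ is pointwise epic. Then every $\rho$-bisimulation between $T$-coalgebras $(X_1,\gamma_1)$ and $(X_2,\gamma_2)$ is a $\rho'$-bisimulation between them.
   Context: Let $\mathcal C,\mathcal A,\mathcal A'$ be categories, $\mathcal C$ with pullbacks and pushouts. Let $U\colon\mathcal A'\to\mathcal A$ have a left adjoint $F\colon\mathcal A\to\mathcal A'$ with counit $\epsilon\colon FU\to\mathrm{Id}_{\mathcal A'}$. Let $P'\colon\mathcal C\to\mathcal A'$ be a contravariant functor that is part of a dual adjunction, and let $P=U\circ P'\colon\mathcal C\to\mathcal A$ also be part of a dual adjunction (a dual adjunction is a pair of contravariant functors with a natural bijection $\mathcal C(X,SA)\cong\mathcal A(A,PX)$). Let $T\colon\mathcal C\to\mathcal C$ be an endofunctor (a $T$-coalgebra is $(X,\gamma)$ with $\gamma\colon X\to TX$), and let $L'\colon\mathcal A'\to\mathcal A'$ with natural $\rho'\colon L'P'\to P'T$, and $L\colon\mathcal A\to\mathcal A$ with natural $\rho\colon LP\to PT$, be logics. A translation from $(L',\rho')$ to $(L,\rho)$ is a natural transformation $\tau\colon LP\to UL'P'$ with $\rho=U\rho'\circ\tau$. For a jointly mono span $X_1\xleftarrow{\pi_1}B\xrightarrow{\pi_2}X_2$ in $\mathcal C$ (i.e. $\pi_1h=\pi_1h'$, $\pi_2h=\pi_2h'$ imply $h=h'$),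 its $\rho$-dual span $(\bar B,\bar\pi_1,\bar\pi_2)$ is the pullback in $\mathcal A$ of $PX_1\xrightarrow{P\pi_1}PB\xleftarrow{P\pi_2}PX_2$, and the span is a $\rho$-bisimulation if $P\pi_1\circ P\gamma_1\circ\rho_{X_1}\circ L\bar\pi_1=P\pi_2\circ P\gamma_2\circ\rho_{X_2}\circ L\bar\pi_2$; $\rho'$-bisimulations are defined in the same way using $P'$, $L'$, $\rho'$ and the pullback in $\mathcal A'$. -}

module Defs where

open import Level using (Level; _⊔_) renaming (suc to lsuc)
open import Relation.Binary using (Rel; IsEquivalence)
open import Data.Product using (Σ; _×_; _,_)

record Category (o ℓ e : Level) : Set (lsuc (o ⊔ ℓ ⊔ e)) where
  infixr 9 _∘_
  infix  4 _≈_
  field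
    Obj       : Set o
    _⇒_       : Obj → Obj → Set ℓ
    _≈_       : ∀ {A B} → Rel (A ⇒ B) e
    id        : ∀ {A} → A ⇒ A
    _∘_       : ∀ {A B C} → B ⇒ C → A ⇒ B → A ⇒ C
    assoc     : ∀ {A B C D} {f : A ⇒ B} {g : B ⇒ C} {h : C ⇒ D} →
                (h ∘ g) ∘ f ≈ h ∘ (g ∘ f)
    identityˡ : ∀ {A B} {f : A ⇒ B} → id ∘ f ≈ f
    identityʳ : ∀ {A B} {f : A ⇒ B} → f ∘ id ≈ f
    equiv     : ∀ {A B} → IsEquivalence (_≈_ {A} {B})
    ∘-resp-≈  : ∀ {A B C} {f h : B ⇒ C} {g i : A ⇒ B} →
                f ≈ h → g ≈ i → f ∘ g ≈ h ∘ i

open Category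

op : ∀ {o ℓ e} → Category o ℓ e → Category o ℓ e
op C = record
  { Obj       = Obj C
  ; _⇒_       = λ A B → _⇒_ C B A
  ; _≈_       = _≈_ C
  ; id        = id C
  ; _∘_       = λ f g → _∘_ C g f
  ; assoc     = IsEquivalence.sym (equiv C) (assoc C)
  ; identityˡ = identityʳ C
  ; identityʳ = identityˡ C
  ; equiv     = equiv C
  ; ∘-resp-≈  = λ p q → ∘-resp-≈ C q p
  }

record Functor {o ℓ e o′ ℓ′ e′} (C : Category o ℓ e) (D : Category o′ ℓ′ e′)
       : Set (o ⊔ ℓ ⊔ e ⊔ o′ ⊔ ℓ′ ⊔ e′) where
  field
    F₀           : Obj C → Obj D
    F₁           : ∀ {A B} → _⇒_ C A B → _⇒_ D (F₀ A) (F₀ B)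
    identity     : ∀ {A} → _≈_ D (F₁ (id C {A})) (id D)
    homomorphism : ∀ {X Y Z} {f : _⇒_ C X Y} {g : _⇒_ C Y Z} →
                   _≈_ D (F₁ (_∘_ C g f)) (_∘_ D (F₁ g) (F₁ f))
    F-resp-≈     : ∀ {A B} {f g : _⇒_ C A B} → _≈_ C f g → _≈_ D (F₁ f) (F₁ g)

open Functor

idF : ∀ {o ℓ e} {C : Category o ℓ e} → Functor C C
idF {C = C} = record
  { F₀ = λ A → A ; F₁ = λ f → f
  ; identity = IsEquivalence.refl (equiv C)
  ; homomorphism = IsEquivalence.refl (equiv C)
  ; F-resp-≈ = λ p → p }

infixr 9 _∘F_
_∘F_ : ∀ {o ℓ e o′ ℓ′ e′ o″ ℓ″ e″}
         {C : Category o ℓ e} {D : Category o′ ℓ′ e′} {E : Category o″ ℓ″ e″} →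
       Functor D E → Functor C D → Functor C E
_∘F_ {E = E} G F = record
  { F₀ = λ A → F₀ G (F₀ F A)
  ; F₁ = λ f → F₁ G (F₁ F f)
  ; identity = IsEquivalence.trans (equiv E) (F-resp-≈ G (identity F)) (identity G)
  ; homomorphism = IsEquivalence.trans (equiv E) (F-resp-≈ G (homomorphism F)) (homomorphism G)
  ; F-resp-≈ = λ p → F-resp-≈ G (F-resp-≈ F p) }

opF : ∀ {o ℓ e o′ ℓ′ e′} {C : Category o ℓ e} {D : Category o′ ℓ′ e′} →
      Functor C D → Functor (op C) (op D)
opF F = record
  { F₀ = F₀ F ; F₁ = F₁ F ; identity = identity F
  ; homomorphism = homomorphism F ; F-resp-≈ = F-resp-≈ F }

record NatTrans {o ℓ e o′ ℓ′ e′} {C : Category o ℓ e} {D : Category o′ ℓ′ e′}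
       (F G : Functor C D) : Set (o ⊔ ℓ ⊔ e ⊔ o′ ⊔ ℓ′ ⊔ e′) where
  field
    η       : ∀ X → _⇒_ D (F₀ F X) (F₀ G X)
    commute : ∀ {X Y} (f : _⇒_ C X Y) →
              _≈_ D (_∘_ D (η Y) (F₁ F f)) (_∘_ D (F₁ G f) (η X))

open NatTrans

record Adjunction {o ℓ e o′ ℓ′ e′} {C : Category o ℓ e} {D : Category o′ ℓ′ e′}
       (F : Functor C D) (U : Functor D C) : Set (o ⊔ ℓ ⊔ e ⊔ o′ ⊔ ℓ′ ⊔ e′) where
  field
    unit   : NatTrans idF (U ∘F F)
    counit : NatTrans (F ∘F U) idF
    zig    : ∀ {A} → _≈_ D (_∘_ D (η counit (F₀ F A)) (F₁ F (η unit A))) (id D)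
    zag    : ∀ {B} → _≈_ C (_∘_ C (F₁ U (η counit B)) (η unit (F₀ U B))) (id C)

-- Dual adjunction between a contravariant S : 𝒜 → 𝒞 (here S : Functor 𝒜 (op 𝒞))
-- and a contravariant P : 𝒞 → 𝒜 (here P : Functor (op 𝒞) 𝒜):
-- a bijection 𝒞(X, S A) ≅ 𝒜(A, P X), natural in X and A.
record DualAdjunction {o ℓ e o′ ℓ′ e′} {C : Category o ℓ e} {A : Category o′ ℓ′ e′}
       (S : Functor A (op C)) (P : Functor (op C) A) : Set (o ⊔ ℓ ⊔ e ⊔ o′ ⊔ ℓ′ ⊔ e′) where
  field
    φ        : ∀ {X a} → _⇒_ C X (F₀ S a) → _⇒_ A a (F₀ P X)
    ψ        : ∀ {X a} → _⇒_ A a (F₀ P X) → _⇒_ C X (F₀ S a)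
    φ-resp-≈ : ∀ {X a} {h h′ : _⇒_ C X (F₀ S a)} → _≈_ C h h′ → _≈_ A (φ h) (φ h′)
    ψ-resp-≈ : ∀ {X a} {k k′ : _⇒_ A a (F₀ P X)} → _≈_ A k k′ → _≈_ C (ψ k) (ψ k′)
    ψ∘φ      : ∀ {X a} (h : _⇒_ C X (F₀ S a)) → _≈_ C (ψ (φ h)) h
    φ∘ψ      : ∀ {X a} (k : _⇒_ A a (F₀ P X)) → _≈_ A (φ (ψ k)) k
    natX     : ∀ {X X′ a} (f : _⇒_ C X′ X) (h : _⇒_ C X (F₀ S a)) →
               _≈_ A (φ (_∘_ C h f)) (_∘_ A (F₁ P f) (φ h))
    natA     : ∀ {X a a′} (g : _⇒_ A a′ a) (h : _⇒_ C X (F₀ S a)) →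
               _≈_ A (φ (_∘_ C (F₁ S g) h)) (_∘_ A (φ h) g)

IsPartOfDualAdjunction : ∀ {o ℓ e o′ ℓ′ e′} {C : Category o ℓ e} {A : Category o′ ℓ′ e′} →
                         Functor (op C) A → Set (o ⊔ ℓ ⊔ e ⊔ o′ ⊔ ℓ′ ⊔ e′)
IsPartOfDualAdjunction {C = C} {A = A} P = Σ (Functor A (op C)) (λ S → DualAdjunction S P)

record IsPullback {o ℓ e} (C : Category o ℓ e) {X₁ X₂ Z : Obj C}
       (f₁ : _⇒_ C X₁ Z) (f₂ : _⇒_ C X₂ Z)
       (Q : Obj C) (q₁ : _⇒_ C Q X₁) (q₂ : _⇒_ C Q X₂) : Set (o ⊔ ℓ ⊔ e) where
  field
    commutes  : _≈_ C (_∘_ C f₁ q₁) (_∘_ C f₂ q₂)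
    universal : ∀ {W} (h₁ : _⇒_ C W X₁) (h₂ : _⇒_ C W X₂) →
                _≈_ C (_∘_ C f₁ h₁) (_∘_ C f₂ h₂) → _⇒_ C W Q
    factor₁   : ∀ {W} (h₁ : _⇒_ C W X₁) (h₂ : _⇒_ C W X₂)
                (eq : _≈_ C (_∘_ C f₁ h₁) (_∘_ C f₂ h₂)) →
                _≈_ C (_∘_ C q₁ (universal h₁ h₂ eq)) h₁
    factor₂   : ∀ {W} (h₁ : _⇒_ C W X₁) (h₂ : _⇒_ C W X₂)
                (eq : _≈_ C (_∘_ C f₁ h₁) (_∘_ C f₂ h₂)) →
                _≈_ C (_∘_ C q₂ (universal h₁ h₂ eq)) h₂
    unique    : ∀ {W} (h₁ : _⇒_ C W X₁) (h₂ : _⇒_ C W X₂)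
                (eq : _≈_ C (_∘_ C f₁ h₁) (_∘_ C f₂ h₂)) (u : _⇒_ C W Q) →
                _≈_ C (_∘_ C q₁ u) h₁ → _≈_ C (_∘_ C q₂ u) h₂ →
                _≈_ C u (universal h₁ h₂ eq)

HasPullbacks : ∀ {o ℓ e} → Category o ℓ e → Set (o ⊔ ℓ ⊔ e)
HasPullbacks C = ∀ {X₁ X₂ Z} (f₁ : _⇒_ C X₁ Z) (f₂ : _⇒_ C X₂ Z) →
  Σ (Obj C) (λ Q → Σ (_⇒_ C Q X₁) (λ q₁ → Σ (_⇒_ C Q X₂) (λ q₂ → IsPullback C f₁ f₂ Q q₁ q₂)))

HasPushouts : ∀ {o ℓ e} → Category o ℓ e → Set (o ⊔ ℓ ⊔ e)
HasPushouts C = HasPullbacks (op C)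

IsEpi : ∀ {o ℓ e} (C : Category o ℓ e) {A B : Obj C} → _⇒_ C A B → Set (o ⊔ ℓ ⊔ e)
IsEpi C {B = B} f = ∀ {Z} (g h : _⇒_ C B Z) → _≈_ C (_∘_ C g f) (_∘_ C h f) → _≈_ C g h

record Coalgebra {o ℓ e} {C : Category o ℓ e} (T : Functor C C) : Set (o ⊔ ℓ) where
  field
    carrier : Obj C
    γ       : _⇒_ C carrier (F₀ T carrier)

open Coalgebra

IsJointlyMono : ∀ {o ℓ e} (C : Category o ℓ e) {B X₁ X₂ : Obj C} →
                _⇒_ C B X₁ → _⇒_ C B X₂ → Set (o ⊔ ℓ ⊔ e)
IsJointlyMono C {B} π₁ π₂ = ∀ {W} (h h′ : _⇒_ C W B) →
  _≈_ C (_∘_ C π₁ h) (_∘_ C π₁ h′) → _≈_ C (_∘_ C π₂ h) (_∘_ C π₂ h′) → _≈_ C h h′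

-- Translation from (L′, ρ′) to (L, ρ) along U, P = U ∘F P′.
IsTranslation : ∀ {o ℓ e o₁ ℓ₁ e₁ o₂ ℓ₂ e₂}
  {C : Category o ℓ e} {A : Category o₁ ℓ₁ e₁} {A′ : Category o₂ ℓ₂ e₂}
  (U : Functor A′ A) (P′ : Functor (op C) A′) (T : Functor C C)
  (L′ : Functor A′ A′) (ρ′ : NatTrans (L′ ∘F P′) (P′ ∘F opF T))
  (L : Functor A A) (ρ : NatTrans (L ∘F (U ∘F P′)) ((U ∘F P′) ∘F opF T))
  (τ : NatTrans (L ∘F (U ∘F P′)) (U ∘F (L′ ∘F P′))) → Set (o ⊔ e₁)
IsTranslation {A = A} U P′ T L′ ρ′ L ρ τ =
  ∀ X → _≈_ A (η ρ X) (_∘_ A (F₁ U (η ρ′ X)) (η τ X))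

-- ρ-bisimulation: for a (the) pullback (B̄, π̄₁, π̄₂) of P X₁ → P B ← P X₂ in 𝒜,
--   Pπ₁ ∘ Pγ₁ ∘ ρ_{X₁} ∘ L π̄₁ = Pπ₂ ∘ Pγ₂ ∘ ρ_{X₂} ∘ L π̄₂.
-- (Pullbacks are unique up to iso, so we require the equation for every pullback.)
IsBisimulation : ∀ {o ℓ e o₁ ℓ₁ e₁} {C : Category o ℓ e} {A : Category o₁ ℓ₁ e₁}
  (T : Functor C C) (P : Functor (op C) A) (L : Functor A A)
  (ρ : NatTrans (L ∘F P) (P ∘F opF T))
  (c₁ c₂ : Coalgebra T) {B : Obj C}
  (π₁ : _⇒_ C B (carrier c₁)) (π₂ : _⇒_ C B (carrier c₂)) → Set (o₁ ⊔ ℓ₁ ⊔ e₁)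
IsBisimulation {A = A} T P L ρ c₁ c₂ π₁ π₂ =
  ∀ (B̄ : Obj A) (π̄₁ : _⇒_ A B̄ (F₀ P (carrier c₁))) (π̄₂ : _⇒_ A B̄ (F₀ P (carrier c₂))) →
  IsPullback A (F₁ P π₁) (F₁ P π₂) B̄ π̄₁ π̄₂ →
  _≈_ A (_∘_ A (F₁ P π₁) (_∘_ A (F₁ P (γ c₁)) (_∘_ A (η ρ (carrier c₁)) (F₁ L π̄₁))))
        (_∘_ A (F₁ P π₂) (_∘_ A (F₁ P (γ c₂)) (_∘_ A (η ρ (carrier c₂)) (F₁ L π̄₂))))

{-# OPTIONS --safe #-}
-- Both dual adjoints send the pushout Y of the span to pullbacks of the dual spans, so the
-- ρ-bisimulation condition can be evaluated at P Y.  Since ρ = Uρ′ ∘ τ and τ is natural, the two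
-- ρ-legs at P Y are the two ρ′-legs at P′ Y (under U) precomposed with τ_Y; as τ♭_Y is epic, the
-- ρ′-legs agree at P′ Y.  Every pullback of the ρ′-dual span factors through P′ Y, so they agree
-- on it as well.
module Submission where

open import Defs
open import Level using (Level)
open import Data.Product using (_,_)
open import Relation.Binary using (Setoid; IsEquivalence)
import Relation.Binary.Reasoning.Setoid as SetoidReasoning

module HomReasoning {o ℓ e} (C : Category o ℓ e) where
  open Category C public

  hom-setoid : Obj → Obj → Setoid ℓ e
  hom-setoid X Y = record { Carrier = X ⇒ Y ; _≈_ = _≈_ ; isEquivalence = equiv }

  module _ {X Y : Obj} where
    open IsEquivalence (equiv {X} {Y}) public
      using () renaming (refl to refl≈; sym to sym≈; trans to trans≈)
    open SetoidReasoning (hom-setoid X Y) public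

  infixr 4 _⟩∘⟨_ refl⟩∘⟨_
  infixl 5 _⟩∘⟨refl

  _⟩∘⟨_ : ∀ {X Y Z} {f h : Y ⇒ Z} {g i : X ⇒ Y} → f ≈ h → g ≈ i → f ∘ g ≈ h ∘ i
  _⟩∘⟨_ = ∘-resp-≈

  refl⟩∘⟨_ : ∀ {X Y Z} {f : Y ⇒ Z} {g i : X ⇒ Y} → g ≈ i → f ∘ g ≈ f ∘ i
  refl⟩∘⟨ p = refl≈ ⟩∘⟨ p

  _⟩∘⟨refl : ∀ {X Y Z} {f h : Y ⇒ Z} {g : X ⇒ Y} → f ≈ h → f ∘ g ≈ h ∘ g
  p ⟩∘⟨refl = p ⟩∘⟨ refl≈

module DualAdjunctionProperties {o ℓ e o₁ ℓ₁ e₁} {C : Category o ℓ e} {A : Category o₁ ℓ₁ e₁}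
         {S : Functor A (op C)} {P : Functor (op C) A} (D : DualAdjunction S P) where
  private
    module C = HomReasoning C
    module P = Functor P
  open HomReasoning A
  open DualAdjunction D

  φ-injective : ∀ {X a} {h h′ : C._⇒_ X (Functor.F₀ S a)} → φ h ≈ φ h′ → h C.≈ h′
  φ-injective {h = h} {h′} p =
    C.trans≈ (C.sym≈ (ψ∘φ h)) (C.trans≈ (ψ-resp-≈ p) (ψ∘φ h′))

  φ-ψ-natural : ∀ {X X′ a} (f : C._⇒_ X′ X) (h : a ⇒ P.F₀ X) → φ (ψ h C.∘ f) ≈ P.F₁ f ∘ h
  φ-ψ-natural f h = trans≈ (natX f (ψ h)) (refl⟩∘⟨ φ∘ψ h)

  pushout⇒pullback : ∀ {X₁ X₂ B Y} {π₁ : C._⇒_ B X₁} {π₂ : C._⇒_ B X₂}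
      {ι₁ : C._⇒_ X₁ Y} {ι₂ : C._⇒_ X₂ Y} →
      IsPullback (op C) π₁ π₂ Y ι₁ ι₂ →
      IsPullback A (P.F₁ π₁) (P.F₁ π₂) (P.F₀ Y) (P.F₁ ι₁) (P.F₁ ι₂)
  pushout⇒pullback {X₁} {X₂} {Y = Y} {π₁} {π₂} {ι₁} {ι₂} po = record
    { commutes  = trans≈ (sym≈ P.homomorphism)
                    (trans≈ (P.F-resp-≈ PO.commutes) P.homomorphism)
    ; universal = λ h₁ h₂ eq → φ (PO.universal (ψ h₁) (ψ h₂) (transposed eq))
    ; factor₁   = λ h₁ h₂ eq → trans≈ (sym≈ (natX ι₁ _))
                    (trans≈ (φ-resp-≈ (PO.factor₁ (ψ h₁) (ψ h₂) (transposed eq))) (φ∘ψ h₁))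
    ; factor₂   = λ h₁ h₂ eq → trans≈ (sym≈ (natX ι₂ _))
                    (trans≈ (φ-resp-≈ (PO.factor₂ (ψ h₁) (ψ h₂) (transposed eq))) (φ∘ψ h₂))
    ; unique    = λ h₁ h₂ eq u p₁ p₂ → trans≈ (sym≈ (φ∘ψ u))
                    (φ-resp-≈ (PO.unique (ψ h₁) (ψ h₂) (transposed eq) (ψ u)
                      (factors-through ι₁ u p₁) (factors-through ι₂ u p₂)))
    }
    where
    module PO = IsPullback po

    transposed : ∀ {W} {h₁ : W ⇒ P.F₀ X₁} {h₂ : W ⇒ P.F₀ X₂} →
                 P.F₁ π₁ ∘ h₁ ≈ P.F₁ π₂ ∘ h₂ → ψ h₁ C.∘ π₁ C.≈ ψ h₂ C.∘ π₂
    transposed {h₁ = h₁} {h₂} eq = φ-injective (begin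
      φ (ψ h₁ C.∘ π₁)  ≈⟨ φ-ψ-natural π₁ h₁ ⟩
      P.F₁ π₁ ∘ h₁     ≈⟨ eq ⟩
      P.F₁ π₂ ∘ h₂     ≈⟨ φ-ψ-natural π₂ h₂ ⟨
      φ (ψ h₂ C.∘ π₂)  ∎)

    factors-through : ∀ {W X} (ι : C._⇒_ X Y) (u : W ⇒ P.F₀ Y) {h : W ⇒ P.F₀ X} →
                      P.F₁ ι ∘ u ≈ h → ψ u C.∘ ι C.≈ ψ h
    factors-through ι u {h} p = φ-injective (begin
      φ (ψ u C.∘ ι)  ≈⟨ φ-ψ-natural ι u ⟩
      P.F₁ ι ∘ u     ≈⟨ p ⟩
      h              ≈⟨ φ∘ψ h ⟨
      φ (ψ h)        ∎)

module AdjunctionProperties {o ℓ e o′ ℓ′ e′} {C : Category o ℓ e} {D : Category o′ ℓ′ e′}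
         {F : Functor C D} {U : Functor D C} (adj : Adjunction F U) where
  private
    module C = Category C
    module F = Functor F
    module U = Functor U
    module ε = NatTrans (Adjunction.counit adj)
  open HomReasoning D

  infix 10 _♭
  _♭ : ∀ {a b} → a C.⇒ U.F₀ b → F.F₀ a ⇒ b
  _♭ {b = b} k = ε.η b ∘ F.F₁ k

  ♭-natural : ∀ {a b c} (g : b ⇒ c) (k : a C.⇒ U.F₀ b) → g ∘ k ♭ ≈ (U.F₁ g C.∘ k) ♭
  ♭-natural g k = begin
    g ∘ (ε.η _ ∘ F.F₁ k)              ≈⟨ assoc ⟨
    (g ∘ ε.η _) ∘ F.F₁ k              ≈⟨ ε.commute g ⟩∘⟨refl ⟨
    (ε.η _ ∘ F.F₁ (U.F₁ g)) ∘ F.F₁ k  ≈⟨ assoc ⟩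
    ε.η _ ∘ (F.F₁ (U.F₁ g) ∘ F.F₁ k)  ≈⟨ refl⟩∘⟨ F.homomorphism ⟨
    ε.η _ ∘ F.F₁ (U.F₁ g C.∘ k)       ∎

  ♭-epi-cancel : ∀ {a b c} {k : a C.⇒ U.F₀ b} {g h : b ⇒ c} → IsEpi D (k ♭) →
                 U.F₁ g C.∘ k C.≈ U.F₁ h C.∘ k → g ≈ h
  ♭-epi-cancel {k = k} {g} {h} epi eq = epi g h (begin
    g ∘ k ♭              ≈⟨ ♭-natural g k ⟩
    (U.F₁ g C.∘ k) ♭     ≈⟨ refl⟩∘⟨ F.F-resp-≈ eq ⟩
    (U.F₁ h C.∘ k) ♭     ≈⟨ ♭-natural h k ⟨
    h ∘ k ♭              ∎)

module BisimulationLegs {o ℓ e o₁ ℓ₁ e₁} {C : Category o ℓ e} {A : Category o₁ ℓ₁ e₁}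
         (T : Functor C C) (P : Functor (op C) A) (L : Functor A A)
         (ρ : NatTrans (L ∘F P) (P ∘F opF T)) where
  private
    module C = Category C
    module P = Functor P
    module L = Functor L
    module ρ = NatTrans ρ
  open HomReasoning A
  open Coalgebra

  bisimLeg : (c : Coalgebra T) {B : C.Obj} (π : B C.⇒ carrier c)
             {Z : Obj} (k : Z ⇒ P.F₀ (carrier c)) → L.F₀ Z ⇒ P.F₀ B
  bisimLeg c π k = P.F₁ π ∘ (P.F₁ (γ c) ∘ (ρ.η (carrier c) ∘ L.F₁ k))

  bisimLeg-∘ : (c : Coalgebra T) {B : C.Obj} (π : B C.⇒ carrier c)
               {Z W : Obj} (k : Z ⇒ P.F₀ (carrier c)) (v : W ⇒ Z) →
               bisimLeg c π (k ∘ v) ≈ bisimLeg c π k ∘ L.F₁ v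
  bisimLeg-∘ c π k v = begin
    P.F₁ π ∘ (P.F₁ (γ c) ∘ (ρ.η _ ∘ L.F₁ (k ∘ v)))          ≈⟨ refl⟩∘⟨ refl⟩∘⟨ refl⟩∘⟨ L.homomorphism ⟩
    P.F₁ π ∘ (P.F₁ (γ c) ∘ (ρ.η _ ∘ (L.F₁ k ∘ L.F₁ v)))     ≈⟨ refl⟩∘⟨ refl⟩∘⟨ assoc ⟨
    P.F₁ π ∘ (P.F₁ (γ c) ∘ ((ρ.η _ ∘ L.F₁ k) ∘ L.F₁ v))     ≈⟨ refl⟩∘⟨ assoc ⟨
    P.F₁ π ∘ ((P.F₁ (γ c) ∘ (ρ.η _ ∘ L.F₁ k)) ∘ L.F₁ v)     ≈⟨ assoc ⟨
    bisimLeg c π k ∘ L.F₁ v                                 ∎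

  bisimulation-from-pullback : (c₁ c₂ : Coalgebra T) {B : C.Obj}
      (π₁ : B C.⇒ carrier c₁) (π₂ : B C.⇒ carrier c₂)
      {Q : Obj} {q₁ : Q ⇒ P.F₀ (carrier c₁)} {q₂ : Q ⇒ P.F₀ (carrier c₂)} →
      IsPullback A (P.F₁ π₁) (P.F₁ π₂) Q q₁ q₂ →
      bisimLeg c₁ π₁ q₁ ≈ bisimLeg c₂ π₂ q₂ →
      IsBisimulation T P L ρ c₁ c₂ π₁ π₂
  bisimulation-from-pullback c₁ c₂ {B} π₁ π₂ {Q} {q₁} {q₂} pb legs B̄ π̄₁ π̄₂ pb̄ = begin
    bisimLeg c₁ π₁ π̄₁           ≈⟨ bisimLeg-resp (sym≈ (pb.factor₁ π̄₁ π̄₂ pb̄.commutes)) ⟩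
    bisimLeg c₁ π₁ (q₁ ∘ v)     ≈⟨ bisimLeg-∘ c₁ π₁ q₁ v ⟩
    bisimLeg c₁ π₁ q₁ ∘ L.F₁ v  ≈⟨ legs ⟩∘⟨refl ⟩
    bisimLeg c₂ π₂ q₂ ∘ L.F₁ v  ≈⟨ bisimLeg-∘ c₂ π₂ q₂ v ⟨
    bisimLeg c₂ π₂ (q₂ ∘ v)     ≈⟨ bisimLeg-resp (pb.factor₂ π̄₁ π̄₂ pb̄.commutes) ⟩
    bisimLeg c₂ π₂ π̄₂           ∎
    where
    module pb = IsPullback pb
    module pb̄ = IsPullback pb̄
    v : B̄ ⇒ Q
    v = pb.universal π̄₁ π̄₂ pb̄.commutes
    bisimLeg-resp : ∀ {c : Coalgebra T} {π : B C.⇒ carrier c} {k k′ : B̄ ⇒ P.F₀ (carrier c)} →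
                    k ≈ k′ → bisimLeg c π k ≈ bisimLeg c π k′
    bisimLeg-resp p = refl⟩∘⟨ refl⟩∘⟨ refl⟩∘⟨ L.F-resp-≈ p

module TranslationProperties {o ℓ e o₁ ℓ₁ e₁ o₂ ℓ₂ e₂}
         {C : Category o ℓ e} {A : Category o₁ ℓ₁ e₁} {A′ : Category o₂ ℓ₂ e₂}
         {U : Functor A′ A} {P′ : Functor (op C) A′} {T : Functor C C}
         {L′ : Functor A′ A′} {ρ′ : NatTrans (L′ ∘F P′) (P′ ∘F opF T)}
         {L : Functor A A} {ρ : NatTrans (L ∘F (U ∘F P′)) ((U ∘F P′) ∘F opF T)}
         {τ : NatTrans (L ∘F (U ∘F P′)) (U ∘F (L′ ∘F P′))}
         (translation : IsTranslation U P′ T L′ ρ′ L ρ τ) where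
  private
    module C = Category C
    module A′ = Category A′
    module U = Functor U
    module P′ = Functor P′
    module L = Functor L
    module L′ = Functor L′
    module ρ′ = NatTrans ρ′
    module τ = NatTrans τ
    module P = Functor (U ∘F P′)
    open BisimulationLegs T P′ L′ ρ′ using () renaming (bisimLeg to bisimLeg′)
  open BisimulationLegs T (U ∘F P′) L ρ using (bisimLeg)
  open HomReasoning A
  open Coalgebra

  bisimLeg-translate : (c : Coalgebra T) {B : C.Obj} (π : B C.⇒ carrier c)
                       {Y : C.Obj} (ι : carrier c C.⇒ Y) →
                       U.F₁ (bisimLeg′ c π (P′.F₁ ι)) ∘ τ.η Y ≈ bisimLeg c π (P.F₁ ι)
  bisimLeg-translate c π {Y} ι = begin
    U.F₁ (bisimLeg′ c π (P′.F₁ ι)) ∘ τ.η Y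
      ≈⟨ U-homomorphism₄ ⟩∘⟨refl ⟩
    (P.F₁ π ∘ (P.F₁ (γ c) ∘ (U.F₁ (ρ′.η X) ∘ U.F₁ (L′.F₁ (P′.F₁ ι))))) ∘ τ.η Y
      ≈⟨ trans≈ assoc (refl⟩∘⟨ trans≈ assoc (refl⟩∘⟨ assoc)) ⟩
    P.F₁ π ∘ (P.F₁ (γ c) ∘ (U.F₁ (ρ′.η X) ∘ (U.F₁ (L′.F₁ (P′.F₁ ι)) ∘ τ.η Y)))
      ≈⟨ refl⟩∘⟨ refl⟩∘⟨ refl⟩∘⟨ τ.commute ι ⟨
    P.F₁ π ∘ (P.F₁ (γ c) ∘ (U.F₁ (ρ′.η X) ∘ (τ.η X ∘ L.F₁ (P.F₁ ι))))
      ≈⟨ refl⟩∘⟨ refl⟩∘⟨ assoc ⟨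
    P.F₁ π ∘ (P.F₁ (γ c) ∘ ((U.F₁ (ρ′.η X) ∘ τ.η X) ∘ L.F₁ (P.F₁ ι)))
      ≈⟨ refl⟩∘⟨ refl⟩∘⟨ translation X ⟩∘⟨refl ⟨
    bisimLeg c π (P.F₁ ι)
      ∎
    where
    X : C.Obj
    X = carrier c
    U-homomorphism₄ : ∀ {a b c d e} {f : d A′.⇒ e} {g : c A′.⇒ d} {h : b A′.⇒ c} {k : a A′.⇒ b} →
                      U.F₁ (f A′.∘ (g A′.∘ (h A′.∘ k))) ≈ U.F₁ f ∘ (U.F₁ g ∘ (U.F₁ h ∘ U.F₁ k))
    U-homomorphism₄ = trans≈ U.homomorphism (refl⟩∘⟨ trans≈ U.homomorphism (refl⟩∘⟨ U.homomorphism))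

open DualAdjunctionProperties using (pushout⇒pullback)
open AdjunctionProperties using (♭-epi-cancel)
open BisimulationLegs using (bisimulation-from-pullback)

proposition4p11 :
    ∀ {o ℓ e o₁ ℓ₁ e₁ o₂ ℓ₂ e₂ : Level}
      (C : Category o ℓ e) (A : Category o₁ ℓ₁ e₁) (A′ : Category o₂ ℓ₂ e₂) →
      HasPullbacks C → HasPushouts C →
      (U : Functor A′ A) (F : Functor A A′) (adj : Adjunction F U) →
      (P′ : Functor (op C) A′) →
      IsPartOfDualAdjunction P′ →
      IsPartOfDualAdjunction (U ∘F P′) →
      (T : Functor C C) →
      (L′ : Functor A′ A′) (ρ′ : NatTrans (L′ ∘F P′) (P′ ∘F opF T)) →
      (L : Functor A A) (ρ : NatTrans (L ∘F (U ∘F P′)) ((U ∘F P′) ∘F opF T)) →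
      (τ : NatTrans (L ∘F (U ∘F P′)) (U ∘F (L′ ∘F P′))) →
      IsTranslation U P′ T L′ ρ′ L ρ τ →
      -- τ♭_X = ε_{L′P′X} ∘ F τ_X is epic for every X
      (∀ X → IsEpi A′ (Category._∘_ A′
                         (NatTrans.η (Adjunction.counit adj) (Functor.F₀ (L′ ∘F P′) X))
                         (Functor.F₁ F (NatTrans.η τ X)))) →
      (c₁ c₂ : Coalgebra T) {B : Category.Obj C}
      (π₁ : Category._⇒_ C B (Coalgebra.carrier c₁))
      (π₂ : Category._⇒_ C B (Coalgebra.carrier c₂)) →
      IsJointlyMono C π₁ π₂ →
      IsBisimulation T (U ∘F P′) L ρ c₁ c₂ π₁ π₂ →
      IsBisimulation T P′ L′ ρ′ c₁ c₂ π₁ π₂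
proposition4p11 C A A′ _ pushouts U F adj P′ (_ , D′) (_ , D) T L′ ρ′ L ρ τ translation τ♭-epi
                c₁ c₂ π₁ π₂ _ bisim
  with pushouts π₁ π₂
... | Y , ι₁ , ι₂ , pushout =
  bisimulation-from-pullback T P′ L′ ρ′ c₁ c₂ π₁ π₂ (pushout⇒pullback D′ pushout) legs-agree
  where
  open HomReasoning A
  open TranslationProperties {U = U} {P′} {T} {L′} {ρ′} {L} {ρ} {τ} translation
  open BisimulationLegs T (U ∘F P′) L ρ using (bisimLeg)
  open BisimulationLegs T P′ L′ ρ′ using () renaming (bisimLeg to bisimLeg′)

  legs-agree : Category._≈_ A′ (bisimLeg′ c₁ π₁ (Functor.F₁ P′ ι₁)) (bisimLeg′ c₂ π₂ (Functor.F₁ P′ ι₂))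
  legs-agree = ♭-epi-cancel adj (τ♭-epi Y) (begin
    Functor.F₁ U (bisimLeg′ c₁ π₁ (Functor.F₁ P′ ι₁)) ∘ NatTrans.η τ Y  ≈⟨ bisimLeg-translate c₁ π₁ ι₁ ⟩
    bisimLeg c₁ π₁ (Functor.F₁ (U ∘F P′) ι₁)                                   ≈⟨ bisim _ _ _ (pushout⇒pullback D pushout) ⟩
    bisimLeg c₂ π₂ (Functor.F₁ (U ∘F P′) ι₂)                                   ≈⟨ bisimLeg-translate c₂ π₂ ι₂ ⟨
    Functor.F₁ U (bisimLeg′ c₂ π₂ (Functor.F₁ P′ ι₂)) ∘ NatTrans.η τ Y  ∎)
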